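{- For every (finite, simple, undirected) graph $G$, $\dim_{\mathrm{TH}}(G) \leq 2(\mathrm{tw}(G)+1)$, where $\mathrm{tw}(G)$ denotes the treewidth of $G$.
   Context: A graph $G$ on $n$ vertices is a threshold graph if there exist real numbers $a_1,\dots,a_n,b$ such that the $0$-$1$ solutions of $\sum_{i=1}^n a_ix_i\le b$ are exactly the characteristic vectors of the cliques of $G$ (equivalently, $G$ has no induced subgraph isomorphic to $2K_2$, $P_4$ or $C_4$). For graphs $G_1,\dots,G_k$ on the same vertex set $V$, $G=G_1\cap\cdots\cap G_k$ means $V(G)=V$ and $E(G)=E(G_1)\cap\cdots\cap E(G_k)$. The threshold dimension $\dim_{\mathrm{TH}}(G)$ is the smallest $k$ such that there exist threshold graphs $G_1,\dots,G_k$ on $V(G)$ with $G=G_1\cap\cdots\cap G_k$. A tree decomposition of $G$ is a pair $(T,\{X_i: i\in V(T)\})$ with $T$ a tree and $X_i\subseteq V(G)$ such that $\bigcup_i X_i=V(G)$, every edge of $G$ has both ends in some $X_i$, and $X_i\cap X_k\subseteq X_j$ whenever $j$ lies on the $T$-path from $i$ to $k$; its width is $\max_i|X_i|-1$, and $\mathrm{tw}(G)$ is the minimum width of a tree decomposition of $G$. -}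

module Defs where

open import Data.Nat using (ℕ; suc; _≤_)
open import Data.Bool using (Bool; true; false; if_then_else_)
open import Data.Fin using (Fin)
open import Data.Fin.Subset using (Subset; _∈_; ∣_∣)
open import Data.Vec using (lookup)
open import Data.Integer using (ℤ; 0ℤ) renaming (_+_ to _+ℤ_; _≤_ to _≤ℤ_)
open import Data.List using (List; []; _∷_; allFin; foldr)
open import Data.List.Relation.Unary.Unique.Propositional using (Unique)
import Data.List.Membership.Propositional as LMem
open import Data.Product using (Σ; ∃; _×_)
open import Function.Bundles using (_⇔_)
open import Relation.Binary.PropositionalEquality using (_≡_)
open import Relation.Nullary using (¬_)

record Graph (n : ℕ) : Set where
  field
    adj    : Fin n → Fin n → Bool
    sym    : ∀ u v → adj u v ≡ adj v u
    irrefl : ∀ v → adj v v ≡ false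
open Graph public

IsClique : ∀ {n} → Graph n → Subset n → Set
IsClique G S = ∀ u v → u ∈ S → v ∈ S → ¬ (u ≡ v) → adj G u v ≡ true

-- Σ_{i ∈ S} a_i  (i.e. Σ a_i x_i for the characteristic vector x of S)
weight : ∀ {n} → (Fin n → ℤ) → Subset n → ℤ
weight {n} a S = foldr (λ i acc → (if lookup S i then a i else 0ℤ) +ℤ acc) 0ℤ (allFin n)

IsThreshold : ∀ {n} → Graph n → Set
IsThreshold {n} G =
  Σ (Fin n → ℤ) λ a → Σ ℤ λ b → ∀ (S : Subset n) → (weight a S ≤ℤ b) ⇔ IsClique G S

IsIntersection : ∀ {n k} → Graph n → (Fin k → Graph n) → Set
IsIntersection G Gs = ∀ u v → (adj G u v ≡ true) ⇔ (∀ j → adj (Gs j) u v ≡ true)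

ThresholdDimAtMost : ∀ {n} → Graph n → ℕ → Set
ThresholdDimAtMost {n} G d =
  Σ ℕ λ k → k ≤ d × Σ (Fin k → Graph n) λ Gs →
    (∀ j → IsThreshold (Gs j)) × IsIntersection G Gs

data Walk {m : ℕ} (T : Graph m) : Fin m → Fin m → List (Fin m) → Set where
  here : ∀ i → Walk T i i (i ∷ [])
  step : ∀ {i j k vs} → adj T i j ≡ true → Walk T j k vs → Walk T i k (i ∷ vs)

IsPath : ∀ {m} → Graph m → Fin m → Fin m → List (Fin m) → Set
IsPath T i k vs = Walk T i k vs × Unique vs

record IsTree {m : ℕ} (T : Graph m) : Set where
  field
    nonempty  : 1 ≤ m
    connected : ∀ i k → ∃ λ vs → IsPath T i k vs
    unique    : ∀ i k vs ws → IsPath T i k vs → IsPath T i k ws → vs ≡ ws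

-- A tree decomposition of G whose bags all have size ≤ s (i.e. width ≤ s - 1).
record TreeDecomposition {n : ℕ} (G : Graph n) (s : ℕ) : Set where
  field
    m        : ℕ
    T        : Graph m
    isTree   : IsTree T
    bag      : Fin m → Subset n
    covers   : ∀ v → ∃ λ i → v ∈ bag i
    edges    : ∀ u v → adj G u v ≡ true → ∃ λ i → u ∈ bag i × v ∈ bag i
    interp   : ∀ i j k vs → IsPath T i k vs → j LMem.∈ vs →
                 ∀ v → v ∈ bag i → v ∈ bag k → v ∈ bag j
    bagSize  : ∀ i → ∣ bag i ∣ ≤ s

-- Root the tree of the decomposition, order its nodes by a depth-first preorder ≺, and let
-- top v be the first bag containing v. The bags containing v form the subtree below top v,
-- so colouring the vertices greedily in the order of their top bags uses at most s colours
-- and makes every bag rainbow. For each colour c and each of the orders ≺ and its reverse,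
-- take the split graph in which the class c is independent, all other vertices form a clique,
-- and u of colour c is joined to w iff some neighbour of w of colour c has its top bag no
-- later than top u. Its neighbourhoods are nested, so it is threshold, and it contains G.
-- Conversely, a case analysis on the relative position of top u and top w in the tree shows
-- that every non-edge u w of G is missing from one of these 2s graphs.
module Submission where

open import Defs hiding (sym)

open import Data.Bool as Bool using (true; false; if_then_else_)
open import Data.Empty using (⊥; ⊥-elim)
open import Data.Fin as Fin using (Fin; zero; suc; toℕ)
import Data.Fin.Properties as Finₚ
open import Data.Fin.Subset using (Subset; _∈_; _∉_; ∣_∣; _-_)
open import Data.Fin.Subset.Properties
  using (_∈?_; p⊂q⇒∣p∣<∣q∣; ∣p∣≤n; x∈p⇒∣p-x∣<∣p∣; x∈p∧x≢y⇒x∈p-y)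
open import Data.Integer as ℤ using (ℤ; +_; 0ℤ; +≤+)
import Data.Integer.Properties as ℤₚ
open import Data.List using (List; []; _∷_; _++_; tabulate; foldr; reverse; map; filter; allFin)
open import Data.List.Extrema.Nat using (argmin; argmin-all; f[argmin]≤v⁺; min; min≤⊤; min≤v⁺; v<min⁺)
open import Data.List.Membership.Propositional using (lose) renaming (_∈_ to _∈ₗ_; _∉_ to _∉ₗ_)
open import Data.List.Membership.Propositional.Properties using (∈-++⁺ˡ; ∈-++⁺ʳ; ∈-++⁻; ∈-allFin; ∈-filter⁺)
open import Data.List.Properties
  using (++-assoc; ++-identityʳ; reverse-++; reverse-involutive; reverse-injective; ∷-injective; ∷-injectiveʳ)
open import Data.List.Relation.Binary.Lex.Strict as Lexₛ using (Lex-<; base; halt; this; next)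
import Data.List.Relation.Binary.Pointwise as Pointwise
import Data.List.Relation.Unary.All as All
open All using ([]; _∷_)
import Data.List.Relation.Unary.All.Properties as Allₚ
open import Data.List.Relation.Unary.AllPairs using ([]; _∷_)
open import Data.List.Relation.Unary.Any using (here; there)
import Data.List.Relation.Unary.Any.Properties as Anyₚ
open import Data.List.Relation.Unary.Unique.Propositional using (Unique)
open import Data.List.Relation.Unary.Unique.Propositional.Properties using (Unique[x∷xs]⇒x∉xs)
open import Data.Nat
open import Data.Nat.Properties
open import Data.Product using (Σ; ∃; ∃₂; _×_; _,_; proj₁; proj₂; uncurry)
open import Data.Sum using (_⊎_; inj₁; inj₂; swap)
import Data.Vec as Vec
open Vec using (lookup)
import Data.Vec.Properties as Vecₚ
open Vecₚ using ([]=⇒lookup; lookup⇒[]=)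
open import Function using (_∘_; id; flip)
open import Function.Bundles using (mk⇔)
open import Relation.Binary using (IsStrictTotalOrder; tri<; tri≈; tri>)
open import Relation.Binary.PropositionalEquality
open import Relation.Nullary using (¬_; Dec; yes; no; does)
open import Relation.Nullary.Decidable using (dec-true; dec-false; does-⇔; decidable-stable; _×-dec_; ¬?)

open import Algebra.Properties.CommutativeSemigroup +-commutativeSemigroup using (x∙yz≈y∙xz)
open import Algebra.Properties.Monoid.Sum +-0-monoid using (sum)

sum≤n* : ∀ {n} (h : Fin n → ℕ) {c} → (∀ i → h i ≤ c) → sum h ≤ n * c
sum≤n* {zero} h hc = z≤n
sum≤n* {suc n} h hc = +-mono-≤ (hc zero) (sum≤n* (h ∘ suc) (hc ∘ suc))

≤sum : ∀ {n} (h : Fin n → ℕ) x → h x ≤ sum h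
≤sum h zero = m≤m+n _ _
≤sum h (suc x) = ≤-trans (≤sum (h ∘ suc) x) (m≤n+m _ _)

pair≤sum : ∀ {n} (h : Fin n → ℕ) {x y} → x ≢ y → h x + h y ≤ sum h
pair≤sum h {zero} {zero} x≢y = ⊥-elim (x≢y refl)
pair≤sum h {zero} {suc y} _ = +-monoʳ-≤ (h zero) (≤sum (h ∘ suc) y)
pair≤sum h {suc x} {zero} _ =
  ≤-trans (≤-reflexive (+-comm (h (suc x)) (h zero))) (+-monoʳ-≤ (h zero) (≤sum (h ∘ suc) x))
pair≤sum h {suc x} {suc y} sx≢sy =
  ≤-trans (pair≤sum (h ∘ suc) (sx≢sy ∘ cong suc)) (m≤n+m _ _)

sum≤at+n* : ∀ {n} (h : Fin n → ℕ) x {c} → (∀ i → i ≢ x → h i ≤ c) → sum h ≤ h x + n * c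
sum≤at+n* h zero hc =
  +-monoʳ-≤ (h zero) (≤-trans (sum≤n* (h ∘ suc) (λ i → hc (suc i) λ ())) (m≤n+m _ _))
sum≤at+n* {suc n} h (suc x) {c} hc = begin
  h zero + sum (h ∘ suc)   ≤⟨ +-mono-≤ (hc zero λ ()) (sum≤at+n* (h ∘ suc) x (λ i i≢x → hc (suc i) (i≢x ∘ Finₚ.suc-injective))) ⟩
  c + (h (suc x) + n * c)  ≡⟨ x∙yz≈y∙xz c (h (suc x)) (n * c) ⟩
  h (suc x) + (c + n * c)  ∎
  where open ≤-Reasoning

module _ {n} {E : Fin n → Fin n → Set} (E? : ∀ u v → Dec (E u v))
         (E-sym : ∀ {u v} → E u v → E v u) (E-irrefl : ∀ {v} → ¬ E v v) where

  graphOf : Graph n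
  graphOf = record
    { adj    = λ u v → does (E? u v)
    ; sym    = λ u v → does-⇔ (mk⇔ E-sym E-sym) (E? u v) (E? v u)
    ; irrefl = λ v → dec-false (E? v v) E-irrefl
    }

  adj-graphOf⁺ : ∀ {u v} → E u v → adj graphOf u v ≡ true
  adj-graphOf⁺ = dec-true (E? _ _)

  adj-graphOf⁻ : ∀ {u v} → adj graphOf u v ≡ true → E u v
  adj-graphOf⁻ {u} {v} with E? u v
  ... | yes e = λ _ → e
  ... | no _  = λ ()

-- The neighbourhoods of the vertices of C are nested, so splitGraph is threshold: with the
-- weights βᶿʷ for w ∉ C and M ∸ n βᵏᵘ for u ∈ C (β = n + 1), a set weighs at most M exactly
-- when it has at most one vertex u in C and every other vertex w has θ w ≤ κ u.
module SplitThreshold {n : ℕ} {C : Fin n → Set} (C? : ∀ v → Dec (C v)) (κ θ : Fin n → ℕ)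
    {K : ℕ} (κ≤K : ∀ v → κ v ≤ K) (θ≤K : ∀ v → θ v ≤ K) where

  data Joined (u v : Fin n) : Set where
    outside        : ¬ C u → ¬ C v → Joined u v
    inside-outside : C u → ¬ C v → θ v ≤ κ u → Joined u v
    outside-inside : ¬ C u → C v → θ u ≤ κ v → Joined u v

  joined? : ∀ u v → Dec (Joined u v)
  joined? u v with C? u | C? v
  ... | yes cu | yes cv = no λ where
    (outside ¬cu _)          → ¬cu cu
    (inside-outside _ ¬cv _) → ¬cv cv
    (outside-inside ¬cu _ _) → ¬cu cu
  ... | yes cu | no ¬cv with θ v ≤? κ u
  ...   | yes θ≤κ = yes (inside-outside cu ¬cv θ≤κ)
  ...   | no θ≰κ  = no λ where
    (outside ¬cu _)          → ¬cu cu
    (inside-outside _ _ θ≤κ) → θ≰κ θ≤κ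
    (outside-inside _ cv _)  → ¬cv cv
  joined? u v | no ¬cu | yes cv with θ u ≤? κ v
  ...   | yes θ≤κ = yes (outside-inside ¬cu cv θ≤κ)
  ...   | no θ≰κ  = no λ where
    (outside _ ¬cv)          → ¬cv cv
    (inside-outside cu _ _)  → ¬cu cu
    (outside-inside _ _ θ≤κ) → θ≰κ θ≤κ
  joined? u v | no ¬cu | no ¬cv = yes (outside ¬cu ¬cv)

  joined-sym : ∀ {u v} → Joined u v → Joined v u
  joined-sym (outside ¬cu ¬cv)           = outside ¬cv ¬cu
  joined-sym (inside-outside cu ¬cv θ≤κ) = outside-inside ¬cv cu θ≤κ
  joined-sym (outside-inside ¬cu cv θ≤κ) = inside-outside cv ¬cu θ≤κ

  Adjacent : Fin n → Fin n → Set
  Adjacent u v = u ≢ v × Joined u v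

  adjacent? : ∀ u v → Dec (Adjacent u v)
  adjacent? u v = ¬? (u Fin.≟ v) ×-dec joined? u v

  adjacent-sym : ∀ {u v} → Adjacent u v → Adjacent v u
  adjacent-sym (u≢v , j) = u≢v ∘ sym , joined-sym j

  adjacent-irrefl : ∀ {v} → ¬ Adjacent v v
  adjacent-irrefl (v≢v , _) = v≢v refl

  splitGraph : Graph n
  splitGraph = graphOf adjacent? adjacent-sym adjacent-irrefl

  adjacent⁺ : ∀ {u v} → Adjacent u v → adj splitGraph u v ≡ true
  adjacent⁺ = adj-graphOf⁺ adjacent? adjacent-sym adjacent-irrefl

  adjacent⁻ : ∀ {u v} → adj splitGraph u v ≡ true → Adjacent u v
  adjacent⁻ = adj-graphOf⁻ adjacent? adjacent-sym adjacent-irrefl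

  record Nested (S : Subset n) : Set where
    field
      one-inside : ∀ {u v} → u ∈ S → v ∈ S → C u → C v → u ≡ v
      dominated  : ∀ {u w} → u ∈ S → w ∈ S → C u → ¬ C w → θ w ≤ κ u

  clique⇒nested : ∀ S → IsClique splitGraph S → Nested S
  clique⇒nested S clique = record { one-inside = one-inside ; dominated = dominated }
    where
    one-inside : ∀ {u v} → u ∈ S → v ∈ S → C u → C v → u ≡ v
    one-inside {u} {v} u∈S v∈S cu cv with u Fin.≟ v
    ... | yes u≡v = u≡v
    ... | no u≢v with proj₂ (adjacent⁻ (clique u v u∈S v∈S u≢v))
    ...   | outside ¬cu _          = ⊥-elim (¬cu cu)
    ...   | inside-outside _ ¬cv _ = ⊥-elim (¬cv cv)
    ...   | outside-inside ¬cu _ _ = ⊥-elim (¬cu cu)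

    dominated : ∀ {u w} → u ∈ S → w ∈ S → C u → ¬ C w → θ w ≤ κ u
    dominated {u} {w} u∈S w∈S cu ¬cw
      with proj₂ (adjacent⁻ (clique u w u∈S w∈S λ { refl → ¬cw cu }))
    ... | outside ¬cu _          = ⊥-elim (¬cu cu)
    ... | inside-outside _ _ θ≤κ = θ≤κ
    ... | outside-inside _ cw _  = ⊥-elim (¬cw cw)

  nested⇒clique : ∀ S → Nested S → IsClique splitGraph S
  nested⇒clique S nested u v u∈S v∈S u≢v = adjacent⁺ (u≢v , joined (C? u) (C? v))
    where
    open Nested nested
    joined : Dec (C u) → Dec (C v) → Joined u v
    joined (yes cu)  (yes cv)  = ⊥-elim (u≢v (one-inside u∈S v∈S cu cv))
    joined (yes cu)  (no ¬cv)  = inside-outside cu ¬cv (dominated u∈S v∈S cu ¬cv)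
    joined (no ¬cu)  (yes cv)  = outside-inside ¬cu cv (dominated v∈S u∈S cv ¬cu)
    joined (no ¬cu)  (no ¬cv)  = outside ¬cu ¬cv

  β : ℕ
  β = suc n

  D : ℕ
  D = n * β ^ K

  M : ℕ
  M = suc (D + D)

  weightOf : ∀ i → Dec (C i) → ℕ
  weightOf i (yes _) = M ∸ n * β ^ κ i
  weightOf i (no _)  = β ^ θ i

  wt : Fin n → ℕ
  wt i = weightOf i (C? i)

  wt-inside : ∀ {i} → C i → wt i ≡ M ∸ n * β ^ κ i
  wt-inside {i} ci with C? i
  ... | yes _   = refl
  ... | no ¬ci  = ⊥-elim (¬ci ci)

  wt-outside : ∀ {i} → ¬ C i → wt i ≡ β ^ θ i
  wt-outside {i} ¬ci with C? i
  ... | yes ci = ⊥-elim (¬ci ci)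
  ... | no _   = refl

  mask : Subset n → Fin n → ℕ
  mask S i = if lookup S i then wt i else 0

  mask-in : ∀ {S i} → i ∈ S → mask S i ≡ wt i
  mask-in i∈S rewrite []=⇒lookup i∈S = refl

  mask-out : ∀ {S i} → i ∉ S → mask S i ≡ 0
  mask-out {S} {i} i∉S with lookup S i in eq
  ... | true  = ⊥-elim (i∉S (lookup⇒[]= i S eq))
  ... | false = refl

  mask-pair : ∀ {S u w} → u ∈ S → w ∈ S → mask S u + mask S w ≡ wt u + wt w
  mask-pair u∈S w∈S = cong₂ _+_ (mask-in u∈S) (mask-in w∈S)

  a : Fin n → ℤ
  a i = + wt i

  weight≡sum : ∀ S → weight a S ≡ + sum (mask S)
  weight≡sum S = go id
    where
    go : ∀ {k} (h : Fin k → Fin n) →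
         foldr (λ i acc → (if lookup S i then a i else 0ℤ) ℤ.+ acc) 0ℤ (tabulate h) ≡ + sum (mask S ∘ h)
    go {zero} h = refl
    go {suc k} h rewrite go (h ∘ suc) with lookup S (h zero)
    ... | true  = refl
    ... | false = refl

  βᵏ≤D : ∀ u → n * β ^ κ u ≤ D
  βᵏ≤D u = *-monoʳ-≤ n (^-monoʳ-≤ β (κ≤K u))

  βᵏ≤M : ∀ u → n * β ^ κ u ≤ M
  βᵏ≤M u = ≤-trans (βᵏ≤D u) (≤-trans (m≤m+n D D) (n≤1+n _))

  D<inside : ∀ {u} → C u → D < wt u
  D<inside {u} cu = begin
    suc D                  ≡⟨ m+n∸m≡n D (suc D) ⟨
    D + suc D ∸ D          ≡⟨ cong (_∸ D) (+-suc D D) ⟩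
    M ∸ D                  ≤⟨ ∸-monoʳ-≤ M (βᵏ≤D u) ⟩
    M ∸ n * β ^ κ u        ≡⟨ wt-inside cu ⟨
    wt u                   ∎
    where open ≤-Reasoning

  M<inside+inside : ∀ {u v} → C u → C v → M < wt u + wt v
  M<inside+inside cu cv =
    ≤-trans (s≤s (≤-reflexive (sym (+-suc D D)))) (+-mono-≤ (D<inside cu) (D<inside cv))

  M<inside+outside : ∀ {u w} → C u → ¬ C w → κ u < θ w → M < wt u + wt w
  M<inside+outside {u} {w} cu ¬cw κ<θ = begin
    suc M                                  ≡⟨ cong suc (m∸n+n≡m (βᵏ≤M u)) ⟨
    suc (M ∸ n * β ^ κ u + n * β ^ κ u)    ≡⟨ +-suc _ _ ⟨
    M ∸ n * β ^ κ u + suc (n * β ^ κ u)    ≤⟨ +-monoʳ-≤ _ (+-monoˡ-≤ _ (m^n>0 β (κ u))) ⟩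
    M ∸ n * β ^ κ u + β ^ suc (κ u)        ≤⟨ +-monoʳ-≤ _ (^-monoʳ-≤ β κ<θ) ⟩
    M ∸ n * β ^ κ u + β ^ θ w              ≡⟨ cong₂ _+_ (wt-inside cu) (wt-outside ¬cw) ⟨
    wt u + wt w                            ∎
    where open ≤-Reasoning

  light⇒nested : ∀ S → sum (mask S) ≤ M → Nested S
  light⇒nested S light = record { one-inside = one-inside ; dominated = dominated }
    where
    heavy : ∀ {u w} → u ∈ S → w ∈ S → u ≢ w → M < wt u + wt w → ⊥
    heavy u∈S w∈S u≢w M< =
      ≤⇒≯ light (<-≤-trans M< (subst (_≤ sum (mask S)) (mask-pair u∈S w∈S) (pair≤sum (mask S) u≢w)))

    one-inside : ∀ {u v} → u ∈ S → v ∈ S → C u → C v → u ≡ v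
    one-inside {u} {v} u∈S v∈S cu cv with u Fin.≟ v
    ... | yes u≡v = u≡v
    ... | no u≢v  = ⊥-elim (heavy u∈S v∈S u≢v (M<inside+inside cu cv))

    dominated : ∀ {u w} → u ∈ S → w ∈ S → C u → ¬ C w → θ w ≤ κ u
    dominated {u} {w} u∈S w∈S cu ¬cw with θ w ≤? κ u
    ... | yes θ≤κ = θ≤κ
    ... | no θ≰κ  = ⊥-elim (heavy u∈S w∈S (λ { refl → ¬cw cu }) (M<inside+outside cu ¬cw (≰⇒> θ≰κ)))

  mask≤ : ∀ {S i c} → (i ∈ S → ¬ C i × θ i ≤ c) → mask S i ≤ β ^ c
  mask≤ {S} {i} outside≤ with i ∈? S
  ... | no i∉S  = subst (_≤ _) (sym (mask-out i∉S)) z≤n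
  ... | yes i∈S = subst (_≤ _) (sym (trans (mask-in i∈S) (wt-outside (proj₁ (outside≤ i∈S)))))
                        (^-monoʳ-≤ β (proj₂ (outside≤ i∈S)))

  nested⇒light : ∀ S → Nested S → sum (mask S) ≤ M
  nested⇒light S nested with Finₚ.any? (λ u → u ∈? S ×-dec C? u)
  ... | yes (u , u∈S , cu) = begin
    sum (mask S)                  ≤⟨ sum≤at+n* (mask S) u (λ i i≢u → mask≤ (dominatedBy-u i≢u)) ⟩
    mask S u + n * β ^ κ u        ≡⟨ cong (_+ _) (trans (mask-in u∈S) (wt-inside cu)) ⟩
    M ∸ n * β ^ κ u + n * β ^ κ u ≡⟨ m∸n+n≡m (βᵏ≤M u) ⟩
    M                             ∎
    where
    open ≤-Reasoning
    open Nested nested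
    dominatedBy-u : ∀ {i} → i ≢ u → i ∈ S → ¬ C i × θ i ≤ κ u
    dominatedBy-u i≢u i∈S = ¬ci , dominated u∈S i∈S cu ¬ci
      where ¬ci = λ ci → i≢u (one-inside i∈S u∈S ci cu)
  ... | no noneInside = ≤-trans (sum≤n* (mask S) (λ i → mask≤ (λ i∈S → (λ ci → noneInside (i , i∈S , ci)) , θ≤K i)))
                                (≤-trans (m≤m+n D D) (n≤1+n _))

  splitGraph-isThreshold : IsThreshold splitGraph
  splitGraph-isThreshold = a , + M , λ S → mk⇔
    (λ light → nested⇒clique S (light⇒nested S (ℤₚ.drop‿+≤+ (subst (ℤ._≤ + M) (weight≡sum S) light))))
    (λ clique → subst (ℤ._≤ + M) (sym (weight≡sum S)) (+≤+ (nested⇒light S (clique⇒nested S clique))))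

Unique-++⁻ˡ : ∀ {A : Set} (xs : List A) {ys} → Unique (xs ++ ys) → Unique xs
Unique-++⁻ˡ []       _           = []
Unique-++⁻ˡ (x ∷ xs) (x∉ ∷ uniq) = Allₚ.++⁻ˡ xs x∉ ∷ Unique-++⁻ˡ xs uniq

Unique-++⁻ʳ : ∀ {A : Set} (xs : List A) {ys} → Unique (xs ++ ys) → Unique ys
Unique-++⁻ʳ []       uniq       = uniq
Unique-++⁻ʳ (x ∷ xs) (_ ∷ uniq) = Unique-++⁻ʳ xs uniq

++-suffixes : ∀ {A : Set} (xs ys zs ws : List A) → xs ++ ys ≡ zs ++ ws →
              (∃ λ t → ys ≡ t ++ ws) ⊎ (∃ λ t → ws ≡ t ++ ys)
++-suffixes []       ys zs       ws eq = inj₁ (zs , eq)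
++-suffixes (x ∷ xs) ys []       ws eq = inj₂ (x ∷ xs , sym eq)
++-suffixes (x ∷ xs) ys (z ∷ zs) ws eq = ++-suffixes xs ys zs ws (∷-injectiveʳ eq)

module _ {A : Set} {_<_ : A → A → Set} where

  Lex-<-++ : ∀ xs {y ys} → Lex-< _≡_ _<_ xs (xs ++ y ∷ ys)
  Lex-<-++ []       = halt
  Lex-<-++ (x ∷ xs) = next refl (Lex-<-++ xs)

  Lex-<-prefix-or-diverge : ∀ {xs ys} → Lex-< _≡_ _<_ xs ys →
    (∃ λ t → ys ≡ xs ++ t) ⊎ (∀ e e′ → Lex-< _≡_ _<_ (xs ++ e) (ys ++ e′))
  Lex-<-prefix-or-diverge (base ())
  Lex-<-prefix-or-diverge (halt {y} {ys}) = inj₁ (y ∷ ys , refl)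
  Lex-<-prefix-or-diverge (this x<y)      = inj₂ λ _ _ → this x<y
  Lex-<-prefix-or-diverge (next {x} refl xs<ys) with Lex-<-prefix-or-diverge xs<ys
  ... | inj₁ (t , eq) = inj₁ (t , cong (x ∷_) eq)
  ... | inj₂ diverge  = inj₂ λ e e′ → next refl (diverge e e′)

module Rank {m} {_⊏_ : Fin m → Fin m → Set} (_⊏?_ : ∀ x y → Dec (x ⊏ y))
    (⊏-irrefl : ∀ {x} → ¬ x ⊏ x) (⊏-trans : ∀ {x y z} → x ⊏ y → y ⊏ z → x ⊏ z) where

  below : Fin m → Subset m
  below x = Vec.tabulate (λ y → does (y ⊏? x))

  ∈-below⁻ : ∀ {x y} → y ∈ below x → y ⊏ x
  ∈-below⁻ {x} {y} y∈ with y ⊏? x | trans (sym (Vecₚ.lookup∘tabulate _ y)) ([]=⇒lookup y∈)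
  ... | yes y⊏x | _  = y⊏x
  ... | no _    | ()

  ∈-below⁺ : ∀ {x y} → y ⊏ x → y ∈ below x
  ∈-below⁺ {x} {y} y⊏x = lookup⇒[]= y (below x) (trans (Vecₚ.lookup∘tabulate _ y) (dec-true (y ⊏? x) y⊏x))

  rank : Fin m → ℕ
  rank x = ∣ below x ∣

  rank-mono : ∀ {x y} → x ⊏ y → rank x < rank y
  rank-mono {x} {y} x⊏y = p⊂q⇒∣p∣<∣q∣ ((λ z∈ → ∈-below⁺ (⊏-trans (∈-below⁻ z∈) x⊏y)) , x , ∈-below⁺ x⊏y , ⊏-irrefl ∘ ∈-below⁻)

  rank≤ : ∀ x → rank x ≤ m
  rank≤ x = ∣p∣≤n (below x)

injection⇒≤∣p∣ : ∀ {n k} (p : Subset n) (g : Fin k → Fin n) →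
                 (∀ {i j} → g i ≡ g j → i ≡ j) → (∀ i → g i ∈ p) → k ≤ ∣ p ∣
injection⇒≤∣p∣ {k = zero}  p g g-inj g∈p = z≤n
injection⇒≤∣p∣ {k = suc k} p g g-inj g∈p = <-≤-trans
  (s≤s (injection⇒≤∣p∣ (p - g zero) (g ∘ suc) (Finₚ.suc-injective ∘ g-inj)
                         (λ i → x∈p∧x≢y⇒x∈p-y (g∈p (suc i)) (λ eq → Finₚ.0≢1+n (g-inj (sym eq))))))
  (x∈p⇒∣p-x∣<∣p∣ (g∈p zero))

module GreedyColouring {n s : ℕ} {_◃_ : Fin n → Fin n → Set} (_◃?_ : ∀ u v → Dec (u ◃ v))
    (μ : Fin n → ℕ) (◃⇒μ< : ∀ {u v} → u ◃ v → μ u < μ v)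
    (fewPredecessors : ∀ v → ∃ λ (A : Subset n) → ∣ A ∣ < s × (∀ {u} → u ◃ v → u ∈ A)) where

  Used : (Fin n → Fin s) → Fin n → Fin s → Set
  Used f v c = ∃ λ u → u ◃ v × f u ≡ c

  used? : ∀ f v c → Dec (Used f v c)
  used? f v c = Finₚ.any? (λ u → (u ◃? v) ×-dec (f u Fin.≟ c))

  free : ∀ f v → ∃ λ c → ¬ Used f v c
  free f v with Finₚ.any? (λ c → ¬? (used? f v c)) | fewPredecessors v
  ... | yes found | _                  = found
  ... | no none   | A , |A|<s , preds⊆A =
    ⊥-elim (≤⇒≯ (injection⇒≤∣p∣ A user user-injective (preds⊆A ∘ user◃v)) |A|<s)
    where
    used : ∀ c → Used f v c
    used c = decidable-stable (used? f v c) (λ unused → none (c , unused))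
    user : Fin s → Fin n
    user c = proj₁ (used c)
    user◃v : ∀ c → user c ◃ v
    user◃v c = proj₁ (proj₂ (used c))
    user-injective : ∀ {c c′} → user c ≡ user c′ → c ≡ c′
    user-injective {c} {c′} eq = trans (sym (proj₂ (proj₂ (used c)))) (trans (cong f eq) (proj₂ (proj₂ (used c′))))

  recolour : (Fin n → Fin s) → ∀ k v → Dec (μ v ≡ k) → Fin s
  recolour f k v (yes _) = proj₁ (free f v)
  recolour f k v (no _)  = f v

  -- The initial colours are irrelevant: every vertex is recoloured at stage μ v.
  colourUpTo : ℕ → Fin n → Fin s
  colourUpTo zero    v = Fin.fromℕ< (≤-<-trans z≤n (proj₁ (proj₂ (fewPredecessors v))))
  colourUpTo (suc k) v = recolour (colourUpTo k) k v (μ v ≟ k)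

  colourUpTo-stable : ∀ {k v} → μ v < k → colourUpTo k v ≡ proj₁ (free (colourUpTo (μ v)) v)
  colourUpTo-stable {suc k} {v} μv<1+k with μ v ≟ k
  ... | yes refl = refl
  ... | no μv≢k  = colourUpTo-stable (≤∧≢⇒< (≤-pred μv<1+k) μv≢k)

  colouring : Fin n → Fin s
  colouring = colourUpTo (suc (sum μ))

  colouring-eq : ∀ v → colouring v ≡ proj₁ (free (colourUpTo (μ v)) v)
  colouring-eq v = colourUpTo-stable (s≤s (≤sum μ v))

  colouring-proper : ∀ {u v} → u ◃ v → colouring u ≢ colouring v
  colouring-proper {u} {v} u◃v eq = proj₂ (free (colourUpTo (μ v)) v) (u , u◃v , (begin
    colourUpTo (μ v) u                    ≡⟨ colourUpTo-stable (◃⇒μ< u◃v) ⟩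
    proj₁ (free (colourUpTo (μ u)) u)     ≡⟨ colouring-eq u ⟨
    colouring u                           ≡⟨ eq ⟩
    colouring v                           ≡⟨ colouring-eq v ⟩
    proj₁ (free (colourUpTo (μ v)) v)     ∎))
    where open ≡-Reasoning

module _ {m} {T : Graph m} where

  walk-head : ∀ {i k vs} → Walk T i k vs → ∃ λ rest → vs ≡ i ∷ rest
  walk-head (here _)   = [] , refl
  walk-head (step _ _) = _ , refl

  next-on : ∀ {i k vs} → Walk T i k vs → Fin m
  next-on (here i)             = i
  next-on (step {j = j} _ _)   = j

  walk-uncons : ∀ {i k vs} (w : Walk T i k vs) → i ≢ k →
    ∃ λ rest → vs ≡ i ∷ rest × adj T i (next-on w) ≡ true × Walk T (next-on w) k rest
  walk-uncons (here _)   i≢i = ⊥-elim (i≢i refl)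
  walk-uncons (step e w) _   = _ , refl , e , w

  walk-split : ∀ {i k vs y} → Walk T i k vs → y ∈ₗ vs →
    ∃₂ λ pre post → vs ≡ pre ++ y ∷ post × Walk T i y (pre ++ y ∷ []) × Walk T y k (y ∷ post)
  walk-split (here i)                  (here refl) = [] , [] , refl , here i , here i
  walk-split (step {vs = vs} e w)      (here refl) = [] , vs , refl , here _ , step e w
  walk-split (step e w) (there y∈) with walk-split w y∈
  ... | pre , post , eq , w₁ , w₂ = _ ∷ pre , post , cong (_ ∷_) eq , step e w₁ , w₂

  path-split : ∀ {i k vs y} → IsPath T i k vs → y ∈ₗ vs →
    ∃₂ λ pre post → vs ≡ pre ++ y ∷ post × IsPath T i y (pre ++ y ∷ []) × IsPath T y k (y ∷ post)
  path-split (w , uniq) y∈ with walk-split w y∈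
  ... | pre , post , refl , w₁ , w₂ =
    pre , post , refl ,
    (w₁ , Unique-++⁻ˡ (pre ++ _ ∷ []) (subst Unique (sym (++-assoc pre (_ ∷ []) post)) uniq)) ,
    (w₂ , Unique-++⁻ʳ pre uniq)

module RootedTree {m : ℕ} (T : Graph m) (isTree : IsTree T) where

  open IsTree isTree
  open import Data.List.Membership.DecPropositional (Finₚ._≟_ {m}) using () renaming (_∈?_ to _∈ₗ?_)

  root : Fin m
  root = Fin.fromℕ< nonempty

  toRoot : Fin m → List (Fin m)
  toRoot i = proj₁ (connected i root)

  toRoot-path : ∀ i → IsPath T i root (toRoot i)
  toRoot-path i = proj₂ (connected i root)

  toRoot-unique : ∀ {i vs} → IsPath T i root vs → toRoot i ≡ vs
  toRoot-unique p = unique _ root _ _ (toRoot-path _) p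

  toRoot-root : toRoot root ≡ root ∷ []
  toRoot-root = toRoot-unique (here root , [] ∷ [])

  toRoot-head : ∀ i → ∃ λ rest → toRoot i ≡ i ∷ rest
  toRoot-head i = walk-head (proj₁ (toRoot-path i))

  toRoot-injective : ∀ {a b} → toRoot a ≡ toRoot b → a ≡ b
  toRoot-injective {a} {b} eq with toRoot-head a | toRoot-head b
  ... | _ , eqa | _ , eqb = proj₁ (∷-injective (trans (sym eqa) (trans eq eqb)))

  parent : Fin m → Fin m
  parent i = next-on (proj₁ (toRoot-path i))

  toRoot-parent : ∀ {i} → i ≢ root → toRoot i ≡ i ∷ toRoot (parent i)
  toRoot-parent {i} i≢root with walk-uncons (proj₁ (toRoot-path i)) i≢root
  ... | rest , eq , _ , w = trans eq (cong (i ∷_) (sym (toRoot-unique (w , uniq))))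
    where
    uniq : Unique rest
    uniq with _ ∷ u ← subst Unique eq (proj₂ (toRoot-path i)) = u

  parent-adj : ∀ {i} → i ≢ root → adj T i (parent i) ≡ true
  parent-adj {i} i≢root = proj₁ (proj₂ (proj₂ (walk-uncons (proj₁ (toRoot-path i)) i≢root)))

  fresh-neighbour : ∀ {x y} → adj T y x ≡ true → y ∉ₗ toRoot x → y ≢ root × parent y ≡ x
  fresh-neighbour {x} {y} e y∉ = y≢root , toRoot-injective (∷-injectiveʳ (trans (sym (toRoot-parent y≢root)) toRoot-y))
    where
    toRoot-y : toRoot y ≡ y ∷ toRoot x
    toRoot-y = toRoot-unique (step e (proj₁ (toRoot-path x)) , Allₚ.¬Any⇒All¬ _ y∉ ∷ proj₂ (toRoot-path x))
    y≢root : y ≢ root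
    y≢root refl with toRoot-head x | trans (sym toRoot-y) toRoot-root
    ... | _ , eq | eq′ with () ← trans (sym eq) (∷-injectiveʳ eq′)

  ancestral-neighbour : ∀ {x y} → adj T x y ≡ true → y ∈ₗ toRoot x → x ≢ root × parent x ≡ y
  ancestral-neighbour {x} {y} e y∈ = x≢root , parent≡y
    where
    x≢y : x ≢ y
    x≢y refl with () ← trans (sym e) (irrefl T x)
    x≢root : x ≢ root
    x≢root refl with subst (y ∈ₗ_) toRoot-root y∈
    ... | here y≡x = x≢y (sym y≡x)
    y∈up : y ∈ₗ toRoot (parent x)
    y∈up with subst (y ∈ₗ_) (toRoot-parent x≢root) y∈
    ... | here y≡x  = ⊥-elim (x≢y (sym y≡x))
    ... | there y∈′ = y∈′
    -- x followed by the segment of toRoot (parent x) up to y is a path from x to y,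
    -- so by uniqueness it is the edge x y.
    parent≡y : parent x ≡ y
    parent≡y with path-split (toRoot-path (parent x)) y∈up
    ... | pre , post , eq , (w₁ , u₁) , _ with walk-head w₁
    ...   | _ , head-eq = proj₁ (∷-injective (trans (sym head-eq) (∷-injectiveʳ via-parent≡edge)))
      where
      x∉ : x ∉ₗ pre ++ y ∷ []
      x∉ x∈ = Unique[x∷xs]⇒x∉xs (subst Unique (toRoot-parent x≢root) (proj₂ (toRoot-path x)))
                (subst (x ∈ₗ_) (sym eq) (subst (x ∈ₗ_) (++-assoc pre (y ∷ []) post) (∈-++⁺ˡ x∈)))
      via-parent≡edge : x ∷ pre ++ y ∷ [] ≡ x ∷ y ∷ []
      via-parent≡edge = unique x y _ _ (step (parent-adj x≢root) w₁ , Allₚ.¬Any⇒All¬ _ x∉ ∷ u₁)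
                                       (step e (here y) , (x≢y ∷ []) ∷ [] ∷ [])

  adjacent⇒parent : ∀ {x y} → adj T x y ≡ true → (x ≢ root × parent x ≡ y) ⊎ (y ≢ root × parent y ≡ x)
  adjacent⇒parent {x} {y} e with y ∈ₗ? toRoot x
  ... | yes y∈ = inj₁ (ancestral-neighbour e y∈)
  ... | no y∉  = inj₂ (fresh-neighbour (trans (Graph.sym T y x) e) y∉)

  _⊑_ : Fin m → Fin m → Set
  a ⊑ b = a ∈ₗ toRoot b

  _⊑?_ : ∀ a b → Dec (a ⊑ b)
  a ⊑? b = a ∈ₗ? toRoot b

  ⊑-refl : ∀ {a} → a ⊑ a
  ⊑-refl {a} = subst (a ∈ₗ_) (sym (proj₂ (toRoot-head a))) (here refl)

  ⊑⇒suffix : ∀ {a b} → a ⊑ b → ∃ λ pre → toRoot b ≡ pre ++ toRoot a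
  ⊑⇒suffix a⊑b with path-split (toRoot-path _) a⊑b
  ... | pre , _ , eq , _ , upper = pre , trans eq (cong (pre ++_) (sym (toRoot-unique upper)))

  suffix⇒⊑ : ∀ {a b} pre → toRoot b ≡ pre ++ toRoot a → a ⊑ b
  suffix⇒⊑ pre eq = subst (_ ∈ₗ_) (sym eq) (∈-++⁺ʳ pre ⊑-refl)

  ⊑-trans : ∀ {a b c} → a ⊑ b → b ⊑ c → a ⊑ c
  ⊑-trans a⊑b b⊑c with ⊑⇒suffix a⊑b | ⊑⇒suffix b⊑c
  ... | p₁ , e₁ | p₂ , e₂ = suffix⇒⊑ (p₂ ++ p₁) (trans e₂ (trans (cong (p₂ ++_) e₁) (sym (++-assoc p₂ p₁ _))))

  ⊑-comparable : ∀ {a b c} → a ⊑ c → b ⊑ c → a ⊑ b ⊎ b ⊑ a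
  ⊑-comparable a⊑c b⊑c with ⊑⇒suffix a⊑c | ⊑⇒suffix b⊑c
  ... | p₁ , e₁ | p₂ , e₂ with ++-suffixes p₁ _ p₂ _ (trans (sym e₁) e₂)
  ...   | inj₁ (t , e) = inj₂ (suffix⇒⊑ t e)
  ...   | inj₂ (t , e) = inj₁ (suffix⇒⊑ t e)

  ⊑-parent : ∀ {a b} → b ≢ root → a ⊑ parent b → a ⊑ b
  ⊑-parent b≢root a⊑ = subst (_ ∈ₗ_) (sym (toRoot-parent b≢root)) (there a⊑)

  ⊑-unparent : ∀ {a b} → a ⊑ b → b ≢ root → a ≡ b ⊎ a ⊑ parent b
  ⊑-unparent a⊑b b≢root with subst (_ ∈ₗ_) (toRoot-parent b≢root) a⊑b
  ... | here a≡b = inj₁ a≡b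
  ... | there a⊑ = inj₂ a⊑

  walk-commonAncestor : ∀ {i j vs} → Walk T i j vs → ∃ λ a → a ∈ₗ vs × a ⊑ i × a ⊑ j
  walk-commonAncestor (here i) = i , here refl , ⊑-refl , ⊑-refl
  walk-commonAncestor (step {i} {i′} e w) with walk-commonAncestor w
  ... | a , a∈ , a⊑i′ , a⊑j with adjacent⇒parent e
  ...   | inj₁ (i≢root , refl) = a , there a∈ , ⊑-parent i≢root a⊑i′ , a⊑j
  ...   | inj₂ (i′≢root , refl) with ⊑-unparent a⊑i′ i′≢root
  ...     | inj₂ a⊑i  = a , there a∈ , a⊑i , a⊑j
  ...     | inj₁ refl = i , here refl , ⊑-refl , ⊑-trans (⊑-parent i′≢root ⊑-refl) a⊑j

  fromRoot : Fin m → List (Fin m)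
  fromRoot a = reverse (toRoot a)

  fromRoot-injective : ∀ {a b} → fromRoot a ≡ fromRoot b → a ≡ b
  fromRoot-injective = toRoot-injective ∘ reverse-injective

  ⊑⇒prefix : ∀ {a b} → a ⊑ b → ∃ λ e → fromRoot b ≡ fromRoot a ++ e
  ⊑⇒prefix {a} a⊑b with ⊑⇒suffix a⊑b
  ... | pre , eq = reverse pre , trans (cong reverse eq) (reverse-++ pre (toRoot a))

  prefix⇒⊑ : ∀ {a b} e → fromRoot b ≡ fromRoot a ++ e → a ⊑ b
  prefix⇒⊑ {a} {b} e eq = suffix⇒⊑ (reverse e) (begin
    toRoot b                                ≡⟨ reverse-involutive (toRoot b) ⟨
    reverse (fromRoot b)                    ≡⟨ cong reverse eq ⟩
    reverse (fromRoot a ++ e)               ≡⟨ reverse-++ (fromRoot a) e ⟩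
    reverse e ++ reverse (fromRoot a)       ≡⟨ cong (reverse e ++_) (reverse-involutive (toRoot a)) ⟩
    reverse e ++ toRoot a                   ∎)
    where open ≡-Reasoning

  -- The preorder of a depth-first traversal visiting children in increasing order.
  _≺_ : Fin m → Fin m → Set
  a ≺ b = Lex-< _≡_ Fin._<_ (fromRoot a) (fromRoot b)

  private
    module Lex = IsStrictTotalOrder (Lexₛ.<-isStrictTotalOrder (Finₚ.<-isStrictTotalOrder {m}))

  _≺?_ : ∀ a b → Dec (a ≺ b)
  a ≺? b = fromRoot a Lex.<? fromRoot b

  ≺-irrefl : ∀ {a} → ¬ a ≺ a
  ≺-irrefl = Lex.irrefl (Pointwise.≡⇒Pointwise-≡ refl)

  ≺-trans : ∀ {a b c} → a ≺ b → b ≺ c → a ≺ c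
  ≺-trans = Lex.trans

  ⊏⇒≺ : ∀ {a b} → a ⊑ b → a ≢ b → a ≺ b
  ⊏⇒≺ {a} a⊑b a≢b with ⊑⇒prefix a⊑b
  ... | []    , eq = ⊥-elim (a≢b (fromRoot-injective (sym (trans eq (++-identityʳ _)))))
  ... | _ ∷ _ , eq = subst (Lex-< _≡_ Fin._<_ (fromRoot a)) (sym eq) (Lex-<-++ (fromRoot a))

  ⊑-≺-trans : ∀ {a b c} → a ⊑ b → b ≺ c → a ≺ c
  ⊑-≺-trans {a} {b} a⊑b b≺c with a Fin.≟ b
  ... | yes refl = b≺c
  ... | no a≢b   = ≺-trans (⊏⇒≺ a⊑b a≢b) b≺c

  ≺-⊑-trans : ∀ {a b c} → a ≺ b → b ⊑ c → a ≺ c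
  ≺-⊑-trans {a} {b} {c} a≺b b⊑c with b Fin.≟ c
  ... | yes refl = a≺b
  ... | no b≢c   = ≺-trans a≺b (⊏⇒≺ b⊑c b≢c)

  ⊑-antisym : ∀ {a b} → a ⊑ b → b ⊑ a → a ≡ b
  ⊑-antisym {a} {b} a⊑b b⊑a with a Fin.≟ b
  ... | yes a≡b = a≡b
  ... | no a≢b  = ⊥-elim (≺-irrefl (≺-trans (⊏⇒≺ a⊑b a≢b) (⊏⇒≺ b⊑a (a≢b ∘ sym))))

  _◁_ : Fin m → Fin m → Set
  a ◁ b = a ≺ b × ¬ a ⊑ b

  ◁-descendants : ∀ {a b a′ b′} → a ◁ b → a ⊑ a′ → b ⊑ b′ → a′ ≺ b′
  ◁-descendants {a} {b} (a≺b , a⋢b) a⊑a′ b⊑b′ with ⊑⇒prefix a⊑a′ | ⊑⇒prefix b⊑b′ | Lex-<-prefix-or-diverge a≺b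
  ... | _ , _     | _ , _      | inj₁ (t , eq) = ⊥-elim (a⋢b (prefix⇒⊑ t eq))
  ... | e , eq-a′ | e′ , eq-b′ | inj₂ diverge  =
    subst₂ (Lex-< _≡_ Fin._<_) (sym eq-a′) (sym eq-b′) (diverge e e′)

  ⊑-or-◁ : ∀ a b → a ⊑ b ⊎ b ⊑ a ⊎ a ◁ b ⊎ b ◁ a
  ⊑-or-◁ a b with Lex.compare (fromRoot a) (fromRoot b)
  ... | tri≈ _ eq _ = inj₁ (subst (a ⊑_) (fromRoot-injective (Pointwise.Pointwise-≡⇒≡ eq)) ⊑-refl)
  ... | tri< a≺b _ _ with a ⊑? b
  ...   | yes a⊑b = inj₁ a⊑b
  ...   | no a⋢b  = inj₂ (inj₂ (inj₁ (a≺b , a⋢b)))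
  ⊑-or-◁ a b | tri> _ _ b≺a with b ⊑? a
  ...   | yes b⊑a = inj₂ (inj₁ b⊑a)
  ...   | no b⋢a  = inj₂ (inj₂ (inj₂ (b≺a , b⋢a)))

lex-< : ∀ {a b i j n} → a < b → i < n → a * n + i < b * n + j
lex-< {a} {b} {i} {j} {n} a<b i<n = begin-strict
  a * n + i  <⟨ +-monoʳ-< (a * n) i<n ⟩
  a * n + n  ≡⟨ +-comm (a * n) n ⟩
  suc a * n  ≤⟨ *-monoˡ-≤ n a<b ⟩
  b * n      ≤⟨ m≤m+n (b * n) j ⟩
  b * n + j  ∎
  where open ≤-Reasoning

module Decomposition {n s : ℕ} {G : Graph n} (td : TreeDecomposition G s) where

  open TreeDecomposition td public
  open RootedTree T isTree public
  open Rank _≺?_ ≺-irrefl ≺-trans using (rank; rank-mono)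

  opaque
    top : Fin n → Fin m
    top v = argmin rank (proj₁ (covers v)) (filter (λ i → v ∈? bag i) (allFin m))

    ∈-top : ∀ v → v ∈ bag (top v)
    ∈-top v = argmin-all rank (proj₂ (covers v)) (Allₚ.all-filter (λ i → v ∈? bag i) (allFin m))

    top-minimal : ∀ {v i} → v ∈ bag i → rank (top v) ≤ rank i
    top-minimal {v} {i} v∈ = f[argmin]≤v⁺ _ _ (inj₂ (lose (∈-filter⁺ (λ i → v ∈? bag i) (∈-allFin i) v∈) ≤-refl))

  -- The path from i to top v passes through a common ancestor, which contains v
  -- by interpolation; if it were not top v it would precede top v.
  top-⊑ : ∀ {v i} → v ∈ bag i → top v ⊑ i
  top-⊑ {v} {i} v∈ with IsTree.connected isTree i (top v)
  ... | vs , path with walk-commonAncestor (proj₁ path)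
  ...   | a , a∈ , a⊑i , a⊑top with a Fin.≟ top v
  ...     | yes refl  = a⊑i
  ...     | no a≢top  = ⊥-elim (<⇒≱ (rank-mono (⊏⇒≺ a⊑top a≢top))
                                   (top-minimal (interp i a (top v) vs path a∈ v v∈ (∈-top v))))

  ∈-bag-between : ∀ {v i c} → v ∈ bag i → c ⊑ i → top v ⊑ c → v ∈ bag c
  ∈-bag-between {v} {i} {c} v∈ c⊑i top⊑c with path-split (toRoot-path i) (top-⊑ v∈)
  ... | pre , post , eq , lower , upper with ∈-++⁻ pre (subst (c ∈ₗ_) eq c⊑i)
  ...   | inj₁ c∈pre = interp i c (top v) _ lower (∈-++⁺ˡ c∈pre) v v∈ (∈-top v)
  ...   | inj₂ c∈upper = subst (λ b → v ∈ bag b) (⊑-antisym top⊑c c⊑top) (∈-top v)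
    where
    c⊑top : c ⊑ top v
    c⊑top = subst (c ∈ₗ_) (sym (toRoot-unique upper)) c∈upper

  ∉⇒≢top : ∀ {x t} → x ∉ bag t → t ≢ top x
  ∉⇒≢top {x} x∉ refl = x∉ (∈-top x)

  Stacked : Fin n → Fin n → Set
  Stacked u w = top u ⊑ top w × u ∈ bag (top w)

  sharedBag : ∀ {u w i} → u ∈ bag i → w ∈ bag i → Stacked u w ⊎ Stacked w u
  sharedBag u∈ w∈ with ⊑-comparable (top-⊑ u∈) (top-⊑ w∈)
  ... | inj₁ tu⊑tw = inj₁ (tu⊑tw , ∈-bag-between u∈ (top-⊑ w∈) tu⊑tw)
  ... | inj₂ tw⊑tu = inj₂ (tw⊑tu , ∈-bag-between w∈ (top-⊑ u∈) tw⊑tu)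

  -- μ orders the vertices by their top bags, ties broken by index. Of two vertices sharing
  -- a bag, the earlier one lies in the top bag of the later one.
  μ : Fin n → ℕ
  μ v = rank (top v) * n + toℕ v

  _◃_ : Fin n → Fin n → Set
  u ◃ v = u ∈ bag (top v) × μ u < μ v

  _◃?_ : ∀ u v → Dec (u ◃ v)
  u ◃? v = (u ∈? bag (top v)) ×-dec (μ u <? μ v)

  stacked⇒◃ : ∀ {u w} → Stacked u w → u ≢ w → u ◃ w ⊎ w ◃ u
  stacked⇒◃ {u} {w} (tu⊑tw , u∈) u≢w with top u Fin.≟ top w
  ... | no tu≢tw = inj₁ (u∈ , lex-< (rank-mono (⊏⇒≺ tu⊑tw tu≢tw)) (Finₚ.toℕ<n u))
  ... | yes tu≡tw with <-cmp (toℕ u) (toℕ w)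
  ...   | tri< u<w _ _ = inj₁ (u∈ , subst (λ t → rank t * n + toℕ u < μ w) (sym tu≡tw) (+-monoʳ-< _ u<w))
  ...   | tri≈ _ u≡w _ = ⊥-elim (u≢w (Finₚ.toℕ-injective u≡w))
  ...   | tri> _ _ w<u = inj₂ ( subst (λ t → w ∈ bag t) (sym tu≡tw) (∈-top w)
                              , subst (λ t → μ w < rank t * n + toℕ u) (sym tu≡tw) (+-monoʳ-< _ w<u))

  sharedBag⇒◃ : ∀ {u w i} → u ∈ bag i → w ∈ bag i → u ≢ w → u ◃ w ⊎ w ◃ u
  sharedBag⇒◃ u∈ w∈ u≢w with sharedBag u∈ w∈
  ... | inj₁ u-stacked = stacked⇒◃ u-stacked u≢w
  ... | inj₂ w-stacked = swap (stacked⇒◃ w-stacked (u≢w ∘ sym))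

  fewPredecessors : ∀ v → ∃ λ (A : Subset n) → ∣ A ∣ < s × (∀ {u} → u ◃ v → u ∈ A)
  fewPredecessors v = bag (top v) - v
                    , <-≤-trans (x∈p⇒∣p-x∣<∣p∣ (∈-top v)) (bagSize (top v))
                    , λ (u∈ , μu<μv) → x∈p∧x≢y⇒x∈p-y u∈ (λ { refl → <-irrefl refl μu<μv })

  private
    module Greedy = GreedyColouring _◃?_ μ proj₂ fewPredecessors

  opaque
    χ : Fin n → Fin s
    χ = Greedy.colouring

    χ-bag : ∀ {u w i} → u ∈ bag i → w ∈ bag i → u ≢ w → χ u ≢ χ w
    χ-bag u∈ w∈ u≢w with sharedBag⇒◃ u∈ w∈ u≢w
    ... | inj₁ u◃w = Greedy.colouring-proper u◃w
    ... | inj₂ w◃u = Greedy.colouring-proper w◃u ∘ sym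

module Cover {n s : ℕ} {G : Graph n} (td : TreeDecomposition G s) where

  open Decomposition td

  ≁⇒≢ : ∀ {u w x} → adj G u w ≡ false → adj G u x ≡ true → x ≢ w
  ≁⇒≢ u≁w u~x refl with () ← trans (sym u~x) u≁w

  ≁-sym : ∀ {u w} → adj G u w ≡ false → adj G w u ≡ false
  ≁-sym {u} {w} = trans (Graph.sym G w u)

  ~⇒≢ : ∀ {u v} → adj G u v ≡ true → u ≢ v
  ~⇒≢ {u} u~u refl with () ← trans (sym u~u) (irrefl G u)

  edge⇒stacked : ∀ {u x} → adj G u x ≡ true → Stacked u x ⊎ Stacked x u
  edge⇒stacked {u} {x} u~x with edges u x u~x
  ... | _ , u∈ , x∈ = sharedBag u∈ x∈

  χ-edge : ∀ {u v} → adj G u v ≡ true → χ u ≢ χ v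
  χ-edge {u} {v} u~v with edges u v u~v
  ... | _ , u∈ , v∈ = χ-bag u∈ v∈ (~⇒≢ u~v)

  order : Fin 2 → Fin m → Fin m → Set
  order zero    = _≺_
  order (suc _) = flip _≺_

  order? : ∀ k a b → Dec (order k a b)
  order? zero    a b = a ≺? b
  order? (suc _) a b = b ≺? a

  order-irrefl : ∀ k {a} → ¬ order k a a
  order-irrefl zero    = ≺-irrefl
  order-irrefl (suc _) = ≺-irrefl

  order-trans : ∀ k {a b c} → order k a b → order k b c → order k a c
  order-trans zero    = ≺-trans
  order-trans (suc _) = flip ≺-trans

  module Rankₖ (k : Fin 2) = Rank (order? k) (order-irrefl k) (order-trans k)

  opaque
    κ : Fin 2 → Fin n → ℕ
    κ k v = Rankₖ.rank k (top v)

    κ<1+m : ∀ k v → κ k v < suc m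
    κ<1+m k v = s≤s (Rankₖ.rank≤ k (top v))

    κ-mono : ∀ k {p x} → order k (top p) (top x) → κ k p < κ k x
    κ-mono k = Rankₖ.rank-mono k

  ColouredNeighbour : Fin s → Fin n → Fin n → Set
  ColouredNeighbour c w x = adj G w x ≡ true × χ x ≡ c

  colouredNeighbour? : ∀ c w x → Dec (ColouredNeighbour c w x)
  colouredNeighbour? c w x = (adj G w x Bool.≟ true) ×-dec (χ x Fin.≟ c)

  opaque
    θ : Fin 2 → Fin s → Fin n → ℕ
    θ k c w = min (suc m) (map (κ k) (filter (colouredNeighbour? c w) (allFin n)))

    θ≤1+m : ∀ k c w → θ k c w ≤ suc m
    θ≤1+m k c w = min≤⊤ (suc m) (map (κ k) (filter (colouredNeighbour? c w) (allFin n)))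

    θ≤κ : ∀ k {c w x} → ColouredNeighbour c w x → θ k c w ≤ κ k x
    θ≤κ k {c} {w} {x} nb =
      min≤v⁺ (suc m) _ (inj₂ (Anyₚ.map⁺ (lose (∈-filter⁺ (colouredNeighbour? c w) (∈-allFin x) nb) ≤-refl)))

    <θ : ∀ k {c w t} → t < suc m → (∀ {x} → ColouredNeighbour c w x → t < κ k x) → t < θ k c w
    <θ k {c} {w} t<1+m t<κ =
      v<min⁺ t<1+m (Allₚ.map⁺ (All.map t<κ (Allₚ.all-filter (colouredNeighbour? c w) (allFin n))))

  module H (k : Fin 2) (c : Fin s) =
    SplitThreshold (λ v → χ v Fin.≟ c) (κ k) (θ k c) (<⇒≤ ∘ κ<1+m k) (θ≤1+m k c)

  edge⇒H : ∀ {u v} k c → adj G u v ≡ true → adj (H.splitGraph k c) u v ≡ true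
  edge⇒H {u} {v} k c u~v = H.adjacent⁺ k c (~⇒≢ u~v , joined (χ u Fin.≟ c) (χ v Fin.≟ c))
    where
    joined : Dec (χ u ≡ c) → Dec (χ v ≡ c) → H.Joined k c u v
    joined (yes refl) (yes χv≡c) = ⊥-elim (χ-edge u~v (sym χv≡c))
    joined (yes χu≡c) (no χv≢c)  = H.inside-outside χu≡c χv≢c (θ≤κ k (trans (Graph.sym G v u) u~v , χu≡c))
    joined (no χu≢c)  (yes χv≡c) = H.outside-inside χu≢c χv≡c (θ≤κ k (u~v , χv≡c))
    joined (no χu≢c)  (no χv≢c)  = H.outside χu≢c χv≢c

  Separated : Fin 2 → Fin n → Fin n → Set
  Separated k p q = ∀ {x} → adj G q x ≡ true → χ x ≡ χ p → order k (top p) (top x)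

  separated⇒¬joined : ∀ k {p q} → χ p ≢ χ q → Separated k p q → ¬ H.Joined k (χ p) p q
  separated⇒¬joined k _ _ (H.outside χp≢χp _) = χp≢χp refl
  separated⇒¬joined k {p} _ sep (H.inside-outside _ _ θq≤κp) =
    <⇒≱ (<θ k (κ<1+m k p) (λ (q~x , χx≡χp) → κ-mono k (sep q~x χx≡χp))) θq≤κp
  separated⇒¬joined k χp≢χq _ (H.outside-inside _ χq≡χp _) = χp≢χq (sym χq≡χp)

  sameColour⇒¬joined : ∀ k {p q} → χ p ≡ χ q → ¬ H.Joined k (χ p) p q
  sameColour⇒¬joined k _     (H.outside χp≢χp _)          = χp≢χp refl
  sameColour⇒¬joined k χp≡χq (H.inside-outside _ χq≢χp _) = χq≢χp (sym χp≡χq)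
  sameColour⇒¬joined k _     (H.outside-inside χp≢χp _ _) = χp≢χp refl

  in-top⇒separated : ∀ {u w} → w ∈ bag (top u) → adj G u w ≡ false → Separated zero w u
  in-top⇒separated {u} {w} w∈tu u≁w {x} u~x χx≡χw = from-stack (edge⇒stacked u~x)
    where
    x∉tu : x ∉ bag (top u)
    x∉tu x∈tu = χ-bag x∈tu w∈tu (≁⇒≢ u≁w u~x) χx≡χw
    from-stack : Stacked u x ⊎ Stacked x u → top w ≺ top x
    from-stack (inj₁ (tu⊑tx , _)) = ⊑-≺-trans (top-⊑ w∈tu) (⊏⇒≺ tu⊑tx (∉⇒≢top x∉tu))
    from-stack (inj₂ (_ , x∈tu))  = ⊥-elim (x∉tu x∈tu)

  above⇒separated : ∀ {u w} → top u ⊑ top w → u ∉ bag (top w) → adj G w u ≡ false → Separated zero u w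
  above⇒separated {u} {w} tu⊑tw u∉tw w≁u {x} w~x χx≡χu = from-stack (edge⇒stacked w~x)
    where
    x∉tu : x ∉ bag (top u)
    x∉tu x∈tu = χ-bag x∈tu (∈-top u) (≁⇒≢ w≁u w~x) χx≡χu
    from-stack : Stacked w x ⊎ Stacked x w → top u ≺ top x
    from-stack (inj₁ (tw⊑tx , _)) = ≺-⊑-trans (⊏⇒≺ tu⊑tw (∉⇒≢top u∉tw ∘ sym)) tw⊑tx
    from-stack (inj₂ (tx⊑tw , x∈tw)) with ⊑-comparable tu⊑tw tx⊑tw
    ... | inj₁ tu⊑tx = ⊏⇒≺ tu⊑tx (∉⇒≢top x∉tu)
    ... | inj₂ tx⊑tu = ⊥-elim (x∉tu (∈-bag-between x∈tw tu⊑tw tx⊑tu))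

  left⇒separated : ∀ {u w} → top w ◁ top u → Separated (suc zero) u w
  left⇒separated tw◁tu w~x _ with edge⇒stacked w~x
  ... | inj₁ (tw⊑tx , _) = ◁-descendants tw◁tu tw⊑tx ⊑-refl
  ... | inj₂ (tx⊑tw , _) = ⊑-≺-trans tx⊑tw (proj₁ tw◁tu)

  Missed : Fin n → Fin n → Set
  Missed u w = Σ (Fin 2 × Fin s) λ (k , c) → ¬ H.Joined k c u w

  missed-sym : ∀ {u w} → Missed w u → Missed u w
  missed-sym ((k , c) , ¬joined) = (k , c) , ¬joined ∘ H.joined-sym k c

  separated⇒missed : ∀ k {p q} → χ p ≢ χ q → Separated k p q → Missed p q
  separated⇒missed k {p} χp≢χq sep = (k , χ p) , separated⇒¬joined k χp≢χq sep

  nonEdge⇒missed : ∀ {u w} → adj G u w ≡ false → Missed u w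
  nonEdge⇒missed {u} {w} u≁w with χ u Fin.≟ χ w
  ... | yes χu≡χw = (zero , χ u) , sameColour⇒¬joined zero χu≡χw
  ... | no χu≢χw with w ∈? bag (top u) | u ∈? bag (top w)
  ...   | yes w∈tu | _        = missed-sym (separated⇒missed zero (χu≢χw ∘ sym) (in-top⇒separated w∈tu u≁w))
  ...   | no _     | yes u∈tw = separated⇒missed zero χu≢χw (in-top⇒separated u∈tw (≁-sym u≁w))
  ...   | no w∉tu  | no u∉tw with ⊑-or-◁ (top u) (top w)
  ...     | inj₁ tu⊑tw               = separated⇒missed zero χu≢χw (above⇒separated tu⊑tw u∉tw (≁-sym u≁w))
  ...     | inj₂ (inj₁ tw⊑tu)        = missed-sym (separated⇒missed zero (χu≢χw ∘ sym) (above⇒separated tw⊑tu w∉tu u≁w))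
  ...     | inj₂ (inj₂ (inj₁ tu◁tw)) = missed-sym (separated⇒missed (suc zero) (χu≢χw ∘ sym) (left⇒separated tu◁tw))
  ...     | inj₂ (inj₂ (inj₂ tw◁tu)) = separated⇒missed (suc zero) χu≢χw (left⇒separated tw◁tu)

  Hs : Fin (2 * s) → Graph n
  Hs j = uncurry H.splitGraph (Fin.remQuot s j)

  Hs-threshold : ∀ j → IsThreshold (Hs j)
  Hs-threshold j = uncurry H.splitGraph-isThreshold (Fin.remQuot s j)

  Hs-combine : ∀ k c → Hs (Fin.combine k c) ≡ H.splitGraph k c
  Hs-combine k c = cong (uncurry H.splitGraph) (Finₚ.remQuot-combine k c)

  G≡⋂Hs : IsIntersection G Hs
  G≡⋂Hs u v = mk⇔ (λ u~v j → uncurry (λ k c → edge⇒H k c u~v) (Fin.remQuot s j)) inAll⇒edge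
    where
    inAll⇒edge : (∀ j → adj (Hs j) u v ≡ true) → adj G u v ≡ true
    inAll⇒edge inAll with adj G u v in u≁v
    ... | true  = refl
    ... | false with nonEdge⇒missed u≁v
    ...   | (k , c) , ¬joined = ⊥-elim (¬joined (proj₂ (H.adjacent⁻ k c
              (subst (λ H → adj H u v ≡ true) (Hs-combine k c) (inAll (Fin.combine k c))))))

theorem4 : ∀ {n} (G : Graph n) (s : ℕ) → TreeDecomposition G s → ThresholdDimAtMost G (2 * s)
theorem4 G s td = 2 * s , ≤-refl , Hs , Hs-threshold , G≡⋂Hs
  where open Cover td
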